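{- No tree of order at least $2$ is factorizable.
   Context: All graphs are finite and simple. A graph $G$ on $n$ vertices is factorizable if there exist graphs $H$ and $K$ on $n$ vertices and adjacency matrices $A,B,C$ of $G,H,K$ respectively (symmetric $n\times n$ $(0,1)$-matrices with zero diagonal, for some vertex orderings) such that $A=BC$. -}

module Defs where

open import Data.Nat using (ℕ; _≤_)
open import Data.Bool using (Bool; true; false; if_then_else_)
open import Data.Fin using (Fin)
open import Data.List using (List; length; allFin; map; take; _++_)
open import Data.Nat.ListAction using (sum)
open import Data.List.Relation.Unary.Unique.Propositional using (Unique)
open import Data.List.Relation.Unary.Linked using (Linked)
open import Data.Fin.Permutation using (Permutation′; _⟨$⟩ʳ_)
open import Data.Product using (Σ; ∃; _×_)
open import Relation.Nullary using (¬_)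
open import Relation.Binary.PropositionalEquality using (_≡_)

record Graph (n : ℕ) : Set where
  field
    adj   : Fin n → Fin n → Bool
    sym   : ∀ i j → adj i j ≡ adj j i
    irrefl : ∀ i → adj i i ≡ false
open Graph public

Adj : ∀ {n} → Graph n → Fin n → Fin n → Set
Adj G u v = adj G u v ≡ true

data Walk {n : ℕ} (G : Graph n) : Fin n → Fin n → Set where
  []  : ∀ {u} → Walk G u u
  _∷_ : ∀ {u v w} → Adj G u v → Walk G v w → Walk G u w

Connected : ∀ {n} → Graph n → Set
Connected G = ∀ u v → Walk G u v

-- A cycle: at least 3 distinct vertices v₀ … v_{k-1}, consecutive ones
-- adjacent, and v_{k-1} adjacent to v₀.
HasCycle : ∀ {n} → Graph n → Set
HasCycle {n} G = Σ (List (Fin n)) λ vs →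
  (3 ≤ length vs) × Unique vs × Linked (Adj G) (vs ++ take 1 vs)

Acyclic : ∀ {n} → Graph n → Set
Acyclic G = ¬ HasCycle G

IsTree : ∀ {n} → Graph n → Set
IsTree G = Connected G × Acyclic G

Matrix : ℕ → Set
Matrix n = Fin n → Fin n → ℕ

adjMatrix : ∀ {n} → Graph n → Permutation′ n → Matrix n
adjMatrix G σ i j = if adj G (σ ⟨$⟩ʳ i) (σ ⟨$⟩ʳ j) then 1 else 0

_·_ : ∀ {n} → Matrix n → Matrix n → Matrix n
(B · C) i j = sum (map (λ k → B i k ℕ.* C k j) (allFin _))
  where import Data.Nat as ℕ

Factorizable : ∀ {n} → Graph n → Set
Factorizable {n} G =
  Σ (Graph n) λ H → Σ (Graph n) λ K →
  Σ (Permutation′ n) λ σ → Σ (Permutation′ n) λ τ → Σ (Permutation′ n) λ ρ →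
  ∀ i j → adjMatrix G σ i j ≡ (adjMatrix H τ · adjMatrix K ρ) i j

-- Let A = BC, where A, B, C are adjacency matrices of a tree T on n ≥ 2 vertices and of
-- graphs H, K (after relabelling, all with respect to one ordering). Entry (i, j) of BC counts
-- the walks i –H– k –K– j, and BC = CB since A, B, C are symmetric. So an edge ij of T has
-- exactly one such k and exactly one l with i –K– l –H– j; then kl is again an edge of T, with
-- middle vertices i and j, and ij ↦ kl is a fixed-point-free involution on the edges: T has an
-- even number n - 1 of edges. Every vertex v has a T-neighbour, hence H- and K-neighbours, and
-- each H-neighbour of v is T-adjacent to each K-neighbour of v; as T has no 4-cycle,
-- deg_H v = 1 or deg_K v = 1, i.e. deg_H v · deg_K v = deg_H v + deg_K v - 1. Summing over v
-- gives 2(n - 1) = 2|E(H)| + 2|E(K)| - n, so n is even: a contradiction.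
module Submission where

open import Defs hiding (sym)
open import Data.Nat using (ℕ; _≤_)
open import Relation.Nullary using (¬_)

open import Data.Bool using (Bool; true; false; if_then_else_; _∧_; not)
import Data.Bool as Bool
open import Data.Bool.Properties using (∧-comm)
open import Data.Empty using (⊥; ⊥-elim)
open import Data.Unit using (⊤)
open import Data.Fin
  using (Fin; zero; suc; toℕ; punchIn; punchOut; _↑ˡ_; _↑ʳ_; combine; remQuot)
open import Data.Fin.Properties
  using (_≟_; any?; toℕ-injective; punchInᵢ≢i; punchIn-punchOut; remQuot-combine; combine-remQuot)
open import Data.Fin.Permutation
  using (Permutation; Permutation′; permutation; _⟨$⟩ʳ_; _⟨$⟩ˡ_; inverseˡ; inverseʳ)
open import Data.List using (List; []; _∷_; _++_; _ʳ++_; [_]; map; take; tabulate; allFin)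
open import Data.List.Properties using (length-map; map-++; take-map; map-tabulate)
open import Data.List.Membership.Propositional using (_∈_)
open import Data.List.Membership.Propositional.Properties using (∈-∃++)
open import Data.List.Relation.Unary.Any as Any using (here; there)
open import Data.List.Relation.Unary.All using ([]; _∷_)
open import Data.List.Relation.Unary.All.Properties using (¬Any⇒All¬; ++⁻ˡ; ++⁻ʳ)
open import Data.List.Relation.Unary.AllPairs using ([]; _∷_)
open import Data.List.Relation.Unary.Linked as Linked using (Linked; [-]; _∷_)
import Data.List.Relation.Unary.Linked.Properties as Linked
open import Data.List.Relation.Unary.Unique.Propositional using (Unique)
import Data.List.Relation.Unary.Unique.Propositional.Properties as Unique
open import Data.Nat using (zero; suc; _+_; _*_; _⊓_; z≤n; s≤s; s≤s⁻¹)
import Data.Nat.ListAction as List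
open import Data.Nat.Properties
  using (+-*-semiring; ≤-refl; ≤-trans; m≤m+n; m≤n+m; <-cmp; _<?_; <⇒≯; ⊓-sel; ⊓-comm;
         +-identityʳ; *-identityʳ; +-assoc; +-comm; suc-injective)
open import Data.Nat.Divisibility
  using (_∣_; _∤_; ∣-refl; m∣m*n; *-monoʳ-∣; *-cancelˡ-∣; ∣1⇒≡1; ∣m∣n⇒∣m+n; ∣m+n∣m⇒∣n)
open import Data.Product using (∃; ∃₂; Σ; _×_; _,_; proj₁; proj₂; swap; uncurry)
open import Data.Sum using (inj₁; inj₂)
open import Function using (_∘_; id)
open import Level using (Level)
open import Relation.Binary.Core using (Rel)
open import Relation.Binary.Definitions using (Symmetric; tri<; tri≈; tri>)
open import Relation.Binary.PropositionalEquality
  using (_≡_; _≢_; refl; sym; trans; cong; cong₂; subst; subst₂; module ≡-Reasoning)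
open import Relation.Nullary using (Dec; yes; no; does; ¬?; _×-dec_; contradiction)
open import Relation.Nullary.Decidable using (dec-true; dec-false)
open import Algebra.Properties.Semiring.Sum +-*-semiring
  using (sum-syntax; sum-cong-≗; sum-remove; ∑-distrib-+; ∑-comm; ∑-permute;
         *-distribˡ-sum; *-distribʳ-sum)

private
  variable
    A : Set
    ℓ : Level
    n : ℕ

-- Counting over Fin

⟦_⟧ : Bool → ℕ
⟦ b ⟧ = if b then 1 else 0

⟦∧⟧ : ∀ x y → ⟦ x ∧ y ⟧ ≡ ⟦ x ⟧ * ⟦ y ⟧
⟦∧⟧ true  y = sym (+-identityʳ ⟦ y ⟧)
⟦∧⟧ false y = refl

⟦⟧≤1 : ∀ b → ⟦ b ⟧ ≤ 1
⟦⟧≤1 true  = ≤-refl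
⟦⟧≤1 false = z≤n

1≤⟦⟧⇒true : ∀ {b} → 1 ≤ ⟦ b ⟧ → b ≡ true
1≤⟦⟧⇒true {true} _ = refl

∧≡true⁻ : ∀ {x y} → x ∧ y ≡ true → x ≡ true × y ≡ true
∧≡true⁻ {true} y≡true = refl , y≡true

∧-cong-if : ∀ {x x′ y y′} → x ≡ x′ → (x ≡ true → y ≡ y′) → x ∧ y ≡ x′ ∧ y′
∧-cong-if {true}  refl y≡y′ = y≡y′ refl
∧-cong-if {false} refl _    = refl

⟦⟧-xor : ∀ {B C : Set} (a : Bool) (b? : Dec B) (c? : Dec C) → (B → a ≡ true) → (C → a ≡ true) →
         (B → C → ⊥) → (a ≡ true → ¬ B → ¬ C → ⊥) → ⟦ a ⟧ ≡ ⟦ does b? ⟧ + ⟦ does c? ⟧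
⟦⟧-xor true  (yes b) (yes c) _   _   b∧c _  = ⊥-elim (b∧c b c)
⟦⟧-xor true  (yes _) (no _)  _   _   _   _  = refl
⟦⟧-xor true  (no _)  (yes _) _   _   _   _  = refl
⟦⟧-xor true  (no ¬b) (no ¬c) _   _   _   a⇒ = ⊥-elim (a⇒ refl ¬b ¬c)
⟦⟧-xor false (yes b) _       b⇒a _   _   _  = contradiction (b⇒a b) λ ()
⟦⟧-xor false (no _)  (yes c) _   c⇒a _   _  = contradiction (c⇒a c) λ ()
⟦⟧-xor false (no _)  (no _)  _   _   _   _  = refl

⟦<?⟧+⟦>?⟧ : ∀ {a b} → a ≢ b → ⟦ does (a <? b) ⟧ + ⟦ does (b <? a) ⟧ ≡ 1
⟦<?⟧+⟦>?⟧ {a} {b} a≢b with <-cmp a b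
... | tri< a<b _ _ rewrite dec-true (a <? b) a<b | dec-false (b <? a) (<⇒≯ a<b) = refl
... | tri≈ _ a≡b _ = contradiction a≡b a≢b
... | tri> _ _ b<a rewrite dec-false (a <? b) (<⇒≯ b<a) | dec-true (b <? a) b<a = refl

∑-1 : ∑[ i < n ] 1 ≡ n
∑-1 {zero}  = refl
∑-1 {suc n} = cong suc ∑-1

≤-∑ : (f : Fin n → ℕ) (i : Fin n) → f i ≤ ∑[ j < n ] f j
≤-∑ f zero    = m≤m+n (f zero) _
≤-∑ f (suc i) = ≤-trans (≤-∑ (f ∘ suc) i) (m≤n+m _ (f zero))

count : (Fin n → Bool) → ℕ
count {n} P = ∑[ i < n ] ⟦ P i ⟧

count-remove : (P : Fin (suc n) → Bool) {i : Fin (suc n)} → P i ≡ true →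
               count P ≡ suc (count (P ∘ punchIn i))
count-remove P {i} Pi =
  trans (sum-remove {i = i} (λ j → ⟦ P j ⟧)) (cong (λ b → ⟦ b ⟧ + count (P ∘ punchIn i)) Pi)

count-none : (P : Fin n → Bool) → (∀ i → P i ≡ false) → count P ≡ 0
count-none {zero}  P none = refl
count-none {suc n} P none rewrite none zero = count-none (P ∘ suc) (none ∘ suc)

count-≟ : (i : Fin n) → count (λ j → does (i ≟ j)) ≡ 1
count-≟ {suc n} i = trans (count-remove (λ j → does (i ≟ j)) (dec-true (i ≟ i) refl))
  (cong suc (count-none _ λ k → dec-false (i ≟ punchIn i k) (punchInᵢ≢i i k ∘ sym)))

count+count-not : (P : Fin n → Bool) → count P + count (not ∘ P) ≡ n
count+count-not {n} P = begin
  count P + count (not ∘ P)             ≡⟨ ∑-distrib-+ (λ i → ⟦ P i ⟧) (λ i → ⟦ not (P i) ⟧) ⟨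
  ∑[ i < n ] (⟦ P i ⟧ + ⟦ not (P i) ⟧)  ≡⟨ sum-cong-≗ (λ i → ⟦⟧+⟦not⟧ (P i)) ⟩
  ∑[ i < n ] 1                          ≡⟨ ∑-1 ⟩
  n                                     ∎
  where
  open ≡-Reasoning
  ⟦⟧+⟦not⟧ : ∀ b → ⟦ b ⟧ + ⟦ not b ⟧ ≡ 1
  ⟦⟧+⟦not⟧ true  = refl
  ⟦⟧+⟦not⟧ false = refl

1≤count : (P : Fin n → Bool) {i : Fin n} → P i ≡ true → 1 ≤ count P
1≤count P {i} Pi = ≤-trans (subst (λ b → 1 ≤ ⟦ b ⟧) (sym Pi) ≤-refl) (≤-∑ (λ j → ⟦ P j ⟧) i)

2≤count : (P : Fin n → Bool) {i j : Fin n} → i ≢ j → P i ≡ true → P j ≡ true → 2 ≤ count P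
2≤count {suc n} P {i} i≢j Pi Pj = subst (2 ≤_) (sym (count-remove P Pi))
  (s≤s (1≤count (P ∘ punchIn i) (trans (cong P (punchIn-punchOut i≢j)) Pj)))

1≤count⇒∃ : (P : Fin n → Bool) → 1 ≤ count P → ∃ λ i → P i ≡ true
1≤count⇒∃ {suc n} P 1≤c with P zero in P0
... | true  = zero , P0
... | false with i , Pi ← 1≤count⇒∃ (P ∘ suc) 1≤c = suc i , Pi

2≤count⇒distinct : (P : Fin n → Bool) → 2 ≤ count P → ∃₂ λ i j → i ≢ j × P i ≡ true × P j ≡ true
2≤count⇒distinct {suc n} P 2≤c
  with i , Pi ← 1≤count⇒∃ P (≤-trans (s≤s z≤n) 2≤c)
  with j , Pj ← 1≤count⇒∃ (P ∘ punchIn i) (s≤s⁻¹ (subst (2 ≤_) (count-remove P Pi) 2≤c))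
  = i , punchIn i j , punchInᵢ≢i i j ∘ sym , Pi , Pj

witness : (Fin n → Bool) → Fin n → Fin n
witness P default with any? (λ k → P k Bool.≟ true)
... | yes (k , _) = k
... | no  _       = default

witness-spec : (P : Fin n → Bool) (default : Fin n) {k : Fin n} → P k ≡ true →
               P (witness P default) ≡ true
witness-spec P default {k} Pk with any? (λ k → P k Bool.≟ true)
... | yes (_ , Pk′) = Pk′
... | no  none      = contradiction (k , Pk) none

-- Involutions and parity

record InvolutionOn (Q : A → Bool) (f : A → A) : Set where
  field
    closed     : ∀ {a} → Q a ≡ true → Q (f a) ≡ true
    involutive : ∀ {a} → Q a ≡ true → f (f a) ≡ a

-- Extending f by the identity off Q gives a permutation of Fin m; reindexing along it
-- exchanges the i ∈ Q with key i < key (f i) and those with key (f i) < key i.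
count-involution : ∀ {m} {Q : Fin m → Bool} {f : Fin m → Fin m} → InvolutionOn Q f →
                   (key : Fin m → ℕ) → (∀ {i} → Q i ≡ true → key (f i) ≢ key i) →
                   count Q ≡ 2 * count (λ i → Q i ∧ does (key i <? key (f i)))
count-involution {m} {Q} {f} inv key separates = begin
  count Q                                                    ≡⟨ sum-cong-≗ split ⟩
  ∑[ i < m ] (⟦ Q i ∧ lt i (f̂ i) ⟧ + ⟦ Q i ∧ lt (f̂ i) i ⟧)
    ≡⟨ ∑-distrib-+ (λ i → ⟦ Q i ∧ lt i (f̂ i) ⟧) (λ i → ⟦ Q i ∧ lt (f̂ i) i ⟧) ⟩
  c + ∑[ i < m ] ⟦ Q i ∧ lt (f̂ i) i ⟧
    ≡⟨ cong (c +_) (trans (sum-cong-≗ reindex) (sym (∑-permute (λ i → ⟦ Q i ∧ lt i (f̂ i) ⟧) π))) ⟩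
  c + c                                                      ≡⟨ cong (c +_) (sym (+-identityʳ c)) ⟩
  2 * c                                                      ≡⟨ cong (2 *_) (sum-cong-≗ f̂≈f) ⟩
  2 * count (λ i → Q i ∧ lt i (f i))                         ∎
  where
  open ≡-Reasoning
  open InvolutionOn inv

  lt : Fin m → Fin m → Bool
  lt i j = does (key i <? key j)

  f̂ : Fin m → Fin m
  f̂ i = if Q i then f i else i

  c : ℕ
  c = count (λ i → Q i ∧ lt i (f̂ i))

  f̂-in : ∀ {i} → Q i ≡ true → f̂ i ≡ f i
  f̂-in Qi rewrite Qi = refl

  f̂-out : ∀ {i} → Q i ≡ false → f̂ i ≡ i
  f̂-out Qi rewrite Qi = refl

  f̂-involutive : ∀ i → f̂ (f̂ i) ≡ i
  f̂-involutive i with Q i in Qi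
  ... | true  = trans (f̂-in (closed Qi)) (involutive Qi)
  ... | false = f̂-out Qi

  Q∘f̂ : ∀ i → Q (f̂ i) ≡ Q i
  Q∘f̂ i with Q i in Qi
  ... | true  = closed Qi
  ... | false = Qi

  π : Permutation m m
  π = permutation f̂ f̂ f̂-involutive f̂-involutive

  split : ∀ i → ⟦ Q i ⟧ ≡ ⟦ Q i ∧ lt i (f̂ i) ⟧ + ⟦ Q i ∧ lt (f̂ i) i ⟧
  split i with Q i in Qi
  ... | true  = sym (⟦<?⟧+⟦>?⟧ (separates Qi ∘ sym))
  ... | false = refl

  reindex : ∀ i → ⟦ Q i ∧ lt (f̂ i) i ⟧ ≡ ⟦ Q (f̂ i) ∧ lt (f̂ i) (f̂ (f̂ i)) ⟧
  reindex i = cong₂ (λ b j → ⟦ b ∧ lt (f̂ i) j ⟧) (sym (Q∘f̂ i)) (sym (f̂-involutive i))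

  f̂≈f : ∀ i → ⟦ Q i ∧ lt i (f̂ i) ⟧ ≡ ⟦ Q i ∧ lt i (f i) ⟧
  f̂≈f i with Q i in Qi
  ... | true  = refl
  ... | false = refl

∑-↑ : ∀ a {b} (g : Fin (a + b) → ℕ) →
      ∑[ k < a + b ] g k ≡ ∑[ i < a ] g (i ↑ˡ b) + ∑[ j < b ] g (a ↑ʳ j)
∑-↑ zero    g = refl
∑-↑ (suc a) g = trans (cong (g zero +_) (∑-↑ a (g ∘ suc))) (sym (+-assoc (g zero) _ _))

∑-combine : ∀ m {n} (g : Fin (m * n) → ℕ) →
            ∑[ k < m * n ] g k ≡ ∑[ i < m ] ∑[ j < n ] g (combine i j)
∑-combine zero        g = refl
∑-combine (suc m) {n} g =
  trans (∑-↑ n g) (cong (∑[ j < n ] g (j ↑ˡ m * n) +_) (∑-combine m (g ∘ (n ↑ʳ_))))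

count₂ : ∀ {m n} → (Fin m × Fin n → Bool) → ℕ
count₂ {m} {n} Q = ∑[ i < m ] ∑[ j < n ] ⟦ Q (i , j) ⟧

-- Sums over Fin can be permuted (∑-permute), so pairs are counted through Fin (m * n).
count₂≡count∘remQuot : ∀ {m n} (Q : Fin m × Fin n → Bool) → count₂ Q ≡ count (Q ∘ remQuot n)
count₂≡count∘remQuot {m} {n} Q = sym (trans (∑-combine m (λ k → ⟦ Q (remQuot n k) ⟧))
  (sum-cong-≗ λ i → sum-cong-≗ λ j → cong (λ p → ⟦ Q p ⟧) (remQuot-combine i j)))

count₂-involution : ∀ {m n} {Q : Fin m × Fin n → Bool} {f : Fin m × Fin n → Fin m × Fin n} →
                    InvolutionOn Q f → (key : Fin m × Fin n → ℕ) →
                    (∀ {p} → Q p ≡ true → key (f p) ≢ key p) →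
                    count₂ Q ≡ 2 * count₂ (λ p → Q p ∧ does (key p <? key (f p)))
count₂-involution {m} {n} {Q} {f} inv key separates = begin
  count₂ Q                                  ≡⟨ count₂≡count∘remQuot Q ⟩
  count (Q ∘ e)                             ≡⟨ count-involution inv′ (key ∘ e) separates′ ⟩
  2 * count (λ k → Q (e k) ∧ does (key (e k) <? key (e (f′ k))))
    ≡⟨ cong (2 *_) (sum-cong-≗ λ k →
         cong (λ p → ⟦ Q (e k) ∧ does (key (e k) <? key p) ⟧) (e∘c (f (e k)))) ⟩
  2 * count (R ∘ e)                         ≡⟨ cong (2 *_) (count₂≡count∘remQuot R) ⟨
  2 * count₂ R                              ∎
  where
  open ≡-Reasoning
  open InvolutionOn inv

  R : Fin m × Fin n → Bool
  R p = Q p ∧ does (key p <? key (f p))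

  e : Fin (m * n) → Fin m × Fin n
  e = remQuot n

  e∘c : ∀ p → e (uncurry combine p) ≡ p
  e∘c (i , j) = remQuot-combine i j

  f′ : Fin (m * n) → Fin (m * n)
  f′ = uncurry combine ∘ f ∘ e

  inv′ : InvolutionOn (Q ∘ e) f′
  inv′ = record
    { closed     = λ {k} Qk → subst (λ p → Q p ≡ true) (sym (e∘c (f (e k)))) (closed Qk)
    ; involutive = λ {k} Qk → trans (cong (uncurry combine ∘ f) (e∘c (f (e k))))
                                    (trans (cong (uncurry combine) (involutive Qk))
                                           (combine-remQuot {m} n k))
    }

  separates′ : ∀ {k} → Q (e k) ≡ true → key (e (f′ k)) ≢ key (e k)
  separates′ {k} Qk = separates Qk ∘ trans (cong key (sym (e∘c (f (e k)))))

count₂-even : {Q : Fin n × Fin n → Bool} → (∀ p → Q (swap p) ≡ Q p) →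
              (∀ {i j} → Q (i , j) ≡ true → i ≢ j) → 2 ∣ count₂ Q
count₂-even {n} {Q} symmetric irreflexive =
  subst (2 ∣_) (sym (count₂-involution {n} {n} swap-involution (toℕ ∘ proj₁) separates)) (m∣m*n half)
  where
  half : ℕ
  half = count₂ (λ p → Q p ∧ does (toℕ (proj₁ p) <? toℕ (proj₁ (swap p))))

  swap-involution : InvolutionOn Q swap
  swap-involution = record { closed = λ {p} Qp → trans (symmetric p) Qp ; involutive = λ _ → refl }

  separates : ∀ {p} → Q p ≡ true → toℕ (proj₂ p) ≢ toℕ (proj₁ p)
  separates Qp = irreflexive Qp ∘ sym ∘ toℕ-injective

-- Walks, paths and non-backtracking walks

adj-sym : ∀ (G : Graph n) {u v} → Adj G u v → Adj G v u
adj-sym G {u} {v} e = trans (Graph.sym G v u) e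

adj⇒≢ : ∀ (G : Graph n) {u v} → Adj G u v → u ≢ v
adj⇒≢ G {u} e refl = contradiction (trans (sym (irrefl G u)) e) λ ()

tail-vertices : ∀ {G : Graph n} {u v} → Walk G u v → List (Fin n)
vertices      : ∀ {G : Graph n} {u v} → Walk G u v → List (Fin n)

tail-vertices []      = []
tail-vertices (_ ∷ w) = vertices w

vertices {u = u} w = u ∷ tail-vertices w

next : ∀ {G : Graph n} {u v} → Walk G u v → Fin n
next {u = u} []                = u
next         (_∷_ {v = w} _ _) = w

vertices-linked : ∀ {G : Graph n} {u v} (w : Walk G u v) → Linked (Adj G) (vertices w)
vertices-linked []      = [-]
vertices-linked (e ∷ w) = e ∷ vertices-linked w

end∈vertices : ∀ {G : Graph n} {u v} (w : Walk G u v) → v ∈ vertices w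
end∈vertices []      = here refl
end∈vertices (_ ∷ w) = there (end∈vertices w)

next-adj : ∀ {G : Graph n} {u r} (p : Walk G u r) → u ≢ r → Adj G u (next p)
next-adj []      u≢r = contradiction refl u≢r
next-adj (e ∷ _) _   = e

Unique-suffix : ∀ {G : Graph n} {u v x} (w : Walk G u v) → x ∈ vertices w → Unique (vertices w) →
                Σ (Walk G x v) (Unique ∘ vertices)
Unique-suffix w       (here refl) U       = w , U
Unique-suffix (_ ∷ w) (there x∈w) (_ ∷ U) = Unique-suffix w x∈w U

walk⇒path : ∀ {G : Graph n} {u v} → Walk G u v → Σ (Walk G u v) (Unique ∘ vertices)
walk⇒path []      = [] , [] ∷ []
walk⇒path {u = u} (e ∷ w) with p , U ← walk⇒path w with Any.any? (u ≟_) (vertices p)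
... | yes u∈p = Unique-suffix p u∈p U
... | no  u∉p = e ∷ p , ¬Any⇒All¬ _ u∉p ∷ U

NonBacktracking : List A → Set
NonBacktracking (x ∷ y ∷ z ∷ vs) = x ≢ z × NonBacktracking (y ∷ z ∷ vs)
NonBacktracking _                = ⊤

NonBacktracking-tail : ∀ {x : A} vs → NonBacktracking (x ∷ vs) → NonBacktracking vs
NonBacktracking-tail []          _        = _
NonBacktracking-tail (_ ∷ [])    _        = _
NonBacktracking-tail (_ ∷ _ ∷ _) (_ , nb) = nb

Unique⇒NonBacktracking : ∀ {vs : List A} → Unique vs → NonBacktracking vs
Unique⇒NonBacktracking {vs = x ∷ y ∷ z ∷ vs} ((_ ∷ x≢z ∷ _) ∷ U) = x≢z , Unique⇒NonBacktracking U
Unique⇒NonBacktracking {vs = []}             _                  = _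
Unique⇒NonBacktracking {vs = _ ∷ []}         _                  = _
Unique⇒NonBacktracking {vs = _ ∷ _ ∷ []}     _                  = _

NonBacktracking-ʳ++ : ∀ {x y : A} xs {ys} → NonBacktracking (y ∷ x ∷ xs) →
                      NonBacktracking (x ∷ y ∷ ys) → NonBacktracking ((x ∷ xs) ʳ++ (y ∷ ys))
NonBacktracking-ʳ++ []       _            nb = nb
NonBacktracking-ʳ++ (_ ∷ xs) (y≢x′ , nb′) nb = NonBacktracking-ʳ++ xs nb′ ((y≢x′ ∘ sym) , nb)

Linked-ʳ++ : ∀ {R : Rel A ℓ} → Symmetric R → ∀ {x y} xs {ys} → Linked R (y ∷ x ∷ xs) →
             Linked R (x ∷ y ∷ ys) → Linked R ((x ∷ xs) ʳ++ (y ∷ ys))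
Linked-ʳ++ R-sym []       _           l = l
Linked-ʳ++ R-sym (_ ∷ xs) (_ ∷ r ∷ l′) l = Linked-ʳ++ R-sym xs (r ∷ l′) (R-sym r ∷ l)

Linked-++⁻ : ∀ {R : Rel A ℓ} xs {y zs} → Linked R (xs ++ y ∷ zs) → Linked R (xs ++ [ y ])
Linked-++⁻ []           _       = [-]
Linked-++⁻ (_ ∷ [])     (r ∷ _) = r ∷ [-]
Linked-++⁻ (_ ∷ x ∷ xs) (r ∷ l) = r ∷ Linked-++⁻ (x ∷ xs) l

Unique-ʳ++⁻ : ∀ (xs : List A) {ys} → Unique (xs ʳ++ ys) → Unique ys
Unique-ʳ++⁻ []       U = U
Unique-ʳ++⁻ (_ ∷ xs) U with _ ∷ U′ ← Unique-ʳ++⁻ xs U = U′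

Unique-ʳ++⇒disjoint : ∀ (xs : List A) {ys z} → Unique (xs ʳ++ ys) → z ∈ xs → z ∈ ys → ⊥
Unique-ʳ++⇒disjoint (_ ∷ xs) U (here refl)  z∈ys = Unique.Unique[x∷xs]⇒x∉xs (Unique-ʳ++⁻ xs U) z∈ys
Unique-ʳ++⇒disjoint (_ ∷ xs) U (there z∈xs) z∈ys = Unique-ʳ++⇒disjoint xs U z∈xs (there z∈ys)

Unique-++-∷ : ∀ ys {x : A} {zs} → Unique (ys ++ x ∷ zs) → Unique (x ∷ ys)
Unique-++-∷ []       _        = [] ∷ []
Unique-++-∷ (_ ∷ ys) (y∉ ∷ U) with x∉ys ∷ Uys ← Unique-++-∷ ys U with y≢x ∷ _ ← ++⁻ʳ ys y∉ =
  ((y≢x ∘ sym) ∷ x∉ys) ∷ (++⁻ˡ ys y∉ ∷ Uys)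

returning-nonBacktracking-walk⇒cycle :
  ∀ {G : Graph n} {x} ys {zs} → Unique (x ∷ ys) → Linked (Adj G) (x ∷ ys ++ x ∷ zs) →
  NonBacktracking (x ∷ ys ++ x ∷ zs) → HasCycle G
returning-nonBacktracking-walk⇒cycle {G = G} []     _ (e ∷ _) _ = contradiction refl (adj⇒≢ G e)
returning-nonBacktracking-walk⇒cycle (_ ∷ [])     _ _ (x≢x , _) = contradiction refl x≢x
returning-nonBacktracking-walk⇒cycle {x = x} ys@(_ ∷ _ ∷ _) U l _ =
  x ∷ ys , s≤s (s≤s (s≤s z≤n)) , U , Linked-++⁻ (x ∷ ys) l

nonBacktracking⇒unique : ∀ {G : Graph n} → Acyclic G → ∀ {vs} → Linked (Adj G) vs →
                         NonBacktracking vs → Unique vs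
nonBacktracking⇒unique         acyclic {[]}     _ _  = []
nonBacktracking⇒unique {G = G} acyclic {x ∷ vs} l nb
  with U ← nonBacktracking⇒unique {G = G} acyclic (Linked.tail l) (NonBacktracking-tail vs nb)
  with Any.any? (x ≟_) vs
... | no  x∉vs = ¬Any⇒All¬ vs x∉vs ∷ U
... | yes x∈vs with ys , zs , refl ← ∈-∃++ x∈vs =
  ⊥-elim (acyclic (returning-nonBacktracking-walk⇒cycle {G = G} ys (Unique-++-∷ ys U) l nb))

-- r ⋯ x y ⋯ r, the reverse of p followed by q, would be a non-backtracking closed walk.
no-nonBacktracking-circuit : ∀ {G : Graph n} → Acyclic G → ∀ {x y r} (p : Walk G x r) (q : Walk G y r) →
                             Adj G x y → NonBacktracking (y ∷ vertices p) →
                             NonBacktracking (x ∷ vertices q) → ⊥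
no-nonBacktracking-circuit {G = G} acyclic p q e nbp nbq =
  Unique-ʳ++⇒disjoint (vertices p) circuit-unique (end∈vertices p) (end∈vertices q)
  where
  circuit-unique : Unique (vertices p ʳ++ vertices q)
  circuit-unique = nonBacktracking⇒unique {G = G} acyclic
    (Linked-ʳ++ (adj-sym G) (tail-vertices p) (adj-sym G e ∷ vertices-linked p) (e ∷ vertices-linked q))
    (NonBacktracking-ʳ++ (tail-vertices p) nbp nbq)

no-mutual-next : ∀ {G : Graph n} → Acyclic G → ∀ {u v r} (p : Walk G u r) (q : Walk G v r) →
                 NonBacktracking (vertices p) → NonBacktracking (vertices q) →
                 u ≢ r → v ≢ r → next p ≡ v → next q ≡ u → ⊥
no-mutual-next acyclic []      _       _   _   u≢r _   _    _    = u≢r refl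
no-mutual-next acyclic (_ ∷ _) []      _   _   _   v≢r _    _    = v≢r refl
no-mutual-next {G = G} acyclic (e ∷ p) (_ ∷ q) nbp nbq _ _ refl refl =
  no-nonBacktracking-circuit acyclic p q (adj-sym G e) nbp nbq

NonBacktracking-∷ : ∀ {G : Graph n} {u r v} (p : Walk G u r) → Unique (vertices p) →
                    (u ≢ r → next p ≢ v) → NonBacktracking (v ∷ vertices p)
NonBacktracking-∷ []      _ _      = _
NonBacktracking-∷ {u = u} {r} (_ ∷ p) U next≢v = next≢v u≢r ∘ sym , Unique⇒NonBacktracking U
  where
  u≢r : u ≢ r
  u≢r u≡r = Unique.Unique[x∷xs]⇒x∉xs U (subst (_∈ vertices p) (sym u≡r) (end∈vertices p))

adj⇒next : ∀ {G : Graph n} → Acyclic G → ∀ {u v r} (p : Walk G u r) (q : Walk G v r) →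
           Unique (vertices p) → Unique (vertices q) → Adj G u v →
           (u ≢ r → next p ≢ v) → (v ≢ r → next q ≢ u) → ⊥
adj⇒next acyclic p q Up Uq e p↛v q↛u =
  no-nonBacktracking-circuit acyclic p q e (NonBacktracking-∷ p Up p↛v) (NonBacktracking-∷ q Uq q↛u)

-- Degrees and trees

degree : Graph n → Fin n → ℕ
degree G v = count (adj G v)

degreeSum : Graph n → ℕ
degreeSum G = count₂ (uncurry (adj G))

degreeSum-even : (G : Graph n) → 2 ∣ degreeSum G
degreeSum-even G = count₂-even (λ (i , j) → Graph.sym G j i) (adj⇒≢ G)

-- Each edge joins a vertex u ≠ r to its parent, the next vertex on its path to r,
-- for exactly one of its two endpoints u.
module Rooted {G : Graph n} (tree : IsTree G) (r : Fin n) where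

  path : ∀ u → Walk G u r
  path u = proj₁ (walk⇒path (proj₁ tree u r))

  path-unique : ∀ u → Unique (vertices (path u))
  path-unique u = proj₂ (walk⇒path (proj₁ tree u r))

  parent : Fin n → Fin n
  parent u = next (path u)

  IsParent : Fin n → Fin n → Set
  IsParent u v = r ≢ u × parent u ≡ v

  isParent? : ∀ u v → Dec (IsParent u v)
  isParent? u v = ¬? (r ≟ u) ×-dec (parent u ≟ v)

  ⟦adj⟧≡isParent+isParent : ∀ u v → ⟦ adj G u v ⟧ ≡ ⟦ does (isParent? u v) ⟧ + ⟦ does (isParent? v u) ⟧
  ⟦adj⟧≡isParent+isParent u v = ⟦⟧-xor (adj G u v) (isParent? u v) (isParent? v u)
    (λ { (r≢u , refl) → next-adj (path u) (r≢u ∘ sym) })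
    (λ { (r≢v , refl) → adj-sym G (next-adj (path v) (r≢v ∘ sym)) })
    (λ (r≢u , pu≡v) (r≢v , pv≡u) → no-mutual-next (proj₂ tree) (path u) (path v)
       (Unique⇒NonBacktracking (path-unique u)) (Unique⇒NonBacktracking (path-unique v))
       (r≢u ∘ sym) (r≢v ∘ sym) pu≡v pv≡u)
    (λ e ¬uv ¬vu → adj⇒next (proj₂ tree) (path u) (path v) (path-unique u) (path-unique v) e
       (λ u≢r pu≡v → ¬uv ((u≢r ∘ sym) , pu≡v)) (λ v≢r pv≡u → ¬vu ((v≢r ∘ sym) , pv≡u)))

  count-isParent : ∀ u → count (λ v → does (isParent? u v)) ≡ ⟦ not (does (r ≟ u)) ⟧
  count-isParent u with r ≟ u
  ... | yes _ = count-none {n} _ (λ _ → refl)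
  ... | no  _ = count-≟ (parent u)

  nonRoots : ℕ
  nonRoots = count (λ u → not (does (r ≟ u)))

  suc-nonRoots : suc nonRoots ≡ n
  suc-nonRoots = trans (cong (_+ nonRoots) (sym (count-≟ r))) (count+count-not (λ u → does (r ≟ u)))

  degreeSum≡2*nonRoots : degreeSum G ≡ 2 * nonRoots
  degreeSum≡2*nonRoots = begin
    degreeSum G
      ≡⟨ sum-cong-≗ (sum-cong-≗ ∘ ⟦adj⟧≡isParent+isParent) ⟩
    ∑[ u < n ] ∑[ v < n ] (π u v + π v u)
      ≡⟨ sum-cong-≗ (λ u → ∑-distrib-+ (π u) (λ v → π v u)) ⟩
    ∑[ u < n ] (∑[ v < n ] π u v + ∑[ v < n ] π v u)
      ≡⟨ ∑-distrib-+ (λ u → ∑[ v < n ] π u v) (λ u → ∑[ v < n ] π v u) ⟩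
    P + ∑[ u < n ] ∑[ v < n ] π v u                   ≡⟨ cong (P +_) (∑-comm (λ u v → π v u)) ⟩
    P + P                                             ≡⟨ cong (P +_) (sym (+-identityʳ P)) ⟩
    2 * P                                             ≡⟨ cong (2 *_) (sum-cong-≗ count-isParent) ⟩
    2 * nonRoots                                      ∎
    where
    open ≡-Reasoning
    π : Fin n → Fin n → ℕ
    π u v = ⟦ does (isParent? u v) ⟧
    P : ℕ
    P = ∑[ u < n ] ∑[ v < n ] π u v

tree-degreeSum : ∀ {m} {G : Graph (suc m)} → IsTree G → degreeSum G ≡ 2 * m
tree-degreeSum tree = trans degreeSum≡2*nonRoots (cong (2 *_) (suc-injective suc-nonRoots))
  where open Rooted tree zero

connected⇒neighbour : ∀ {m} {G : Graph (suc (suc m))} → Connected G → ∀ v → ∃ (Adj G v)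
connected⇒neighbour connected v = _ , next-adj (connected v (punchIn v zero)) (punchInᵢ≢i v zero ∘ sym)

-- Products of graphs

IsProduct : Graph n → Graph n → Graph n → Set
IsProduct {n} G H K = ∀ i j → ⟦ adj G i j ⟧ ≡ count (λ k → adj H i k ∧ adj K k j)

IsProduct-comm : ∀ {G H K : Graph n} → IsProduct G H K → IsProduct G K H
IsProduct-comm {G = G} {H} {K} GHK i j = begin
  ⟦ adj G i j ⟧                        ≡⟨ cong ⟦_⟧ (Graph.sym G i j) ⟩
  ⟦ adj G j i ⟧                        ≡⟨ GHK j i ⟩
  count (λ k → adj H j k ∧ adj K k i)  ≡⟨ sum-cong-≗ (λ k → cong ⟦_⟧ (reverse-path k)) ⟩
  count (λ k → adj K i k ∧ adj H k j)  ∎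
  where
  open ≡-Reasoning
  reverse-path : ∀ k → adj H j k ∧ adj K k i ≡ adj K i k ∧ adj H k j
  reverse-path k = trans (cong₂ _∧_ (Graph.sym H j k) (Graph.sym K k i)) (∧-comm (adj H k j) (adj K i k))

square⇒cycle : ∀ {G : Graph n} {a b c d} → Adj G a b → Adj G b c → Adj G c d → Adj G d a →
               a ≢ c → b ≢ d → HasCycle G
square⇒cycle {G = G} ab bc cd da a≢c b≢d =
  _ ∷ _ ∷ _ ∷ _ ∷ [] , s≤s (s≤s (s≤s z≤n)) ,
  (adj⇒≢ G ab ∷ a≢c ∷ adj⇒≢ G (adj-sym G da) ∷ []) ∷ (adj⇒≢ G bc ∷ b≢d ∷ []) ∷
    (adj⇒≢ G cd ∷ []) ∷ [] ∷ [] ,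
  ab ∷ bc ∷ cd ∷ da ∷ [-]

module Product {G H K : Graph n} (GHK : IsProduct G H K) where

  path⇒adj : ∀ {i k j} → Adj H i k → Adj K k j → Adj G i j
  path⇒adj {i} {k} {j} hik kkj =
    1≤⟦⟧⇒true (subst (1 ≤_) (sym (GHK i j)) (1≤count (λ m → adj H i m ∧ adj K m j) (cong₂ _∧_ hik kkj)))

  middle-exists : ∀ {i j} → Adj G i j → ∃ λ k → Adj H i k × Adj K k j
  middle-exists {i} {j} e
    with k , hk ← 1≤count⇒∃ _ (subst (1 ≤_) (GHK i j) (subst (λ b → 1 ≤ ⟦ b ⟧) (sym e) ≤-refl))
    = k , ∧≡true⁻ hk

  middle-unique : ∀ {i j k k′} → Adj H i k → Adj K k j → Adj H i k′ → Adj K k′ j → k ≡ k′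
  middle-unique {i} {j} {k} {k′} hik kkj hik′ kk′j with k ≟ k′
  ... | yes k≡k′ = k≡k′
  ... | no  k≢k′ = contradiction 2≤1 λ { (s≤s ()) }
    where
    2≤1 : 2 ≤ 1
    2≤1 = ≤-trans (2≤count (λ m → adj H i m ∧ adj K m j) k≢k′ (cong₂ _∧_ hik kkj) (cong₂ _∧_ hik′ kk′j))
                  (subst (_≤ 1) (GHK i j) (⟦⟧≤1 (adj G i j)))

  middle : Fin n → Fin n → Fin n
  middle i j = witness (λ k → adj H i k ∧ adj K k j) i

  middle-spec : ∀ {i j} → Adj G i j → Adj H i (middle i j) × Adj K (middle i j) j
  middle-spec {i} {j} e with k , hik , kkj ← middle-exists e =
    ∧≡true⁻ (witness-spec (λ m → adj H i m ∧ adj K m j) i (cong₂ _∧_ hik kkj))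

  middle≡ : ∀ {i j k} → Adj H i k → Adj K k j → middle i j ≡ k
  middle≡ hik kkj with h , k ← middle-spec (path⇒adj hik kkj) = middle-unique h k hik kkj

  1≤degree : ∀ {v w} → Adj G v w → 1 ≤ degree H v
  1≤degree e with _ , hvk , _ ← middle-exists e = 1≤count (adj H _) hvk

  no-K₂,₂ : Acyclic G → ∀ v → 2 ≤ degree H v → 2 ≤ degree K v → ⊥
  no-K₂,₂ acyclic v 2≤dH 2≤dK
    with p , p′ , p≢p′ , hp , hp′ ← 2≤count⇒distinct (adj H v) 2≤dH
       | q , q′ , q≢q′ , kq , kq′ ← 2≤count⇒distinct (adj K v) 2≤dK
    = acyclic (square⇒cycle {G = G} (path⇒adj (adj-sym H hp) kq)
                                    (adj-sym G (path⇒adj (adj-sym H hp′) kq))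
                                    (path⇒adj (adj-sym H hp′) kq′)
                                    (adj-sym G (path⇒adj (adj-sym H hp) kq′))
                                    p≢p′ q≢q′)

  degreeSum≡∑degree*degree : degreeSum G ≡ ∑[ k < n ] (degree H k * degree K k)
  degreeSum≡∑degree*degree = begin
    ∑[ i < n ] ∑[ j < n ] ⟦ adj G i j ⟧
      ≡⟨ sum-cong-≗ (λ i → sum-cong-≗ λ j →
           trans (GHK i j) (sum-cong-≗ λ k → ⟦∧⟧ (adj H i k) (adj K k j))) ⟩
    ∑[ i < n ] ∑[ j < n ] ∑[ k < n ] (h i k * c k j)
      ≡⟨ sum-cong-≗ (λ i → ∑-comm (λ j k → h i k * c k j)) ⟩
    ∑[ i < n ] ∑[ k < n ] ∑[ j < n ] (h i k * c k j)
      ≡⟨ ∑-comm (λ i k → ∑[ j < n ] (h i k * c k j)) ⟩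
    ∑[ k < n ] ∑[ i < n ] ∑[ j < n ] (h i k * c k j)
      ≡⟨ sum-cong-≗ (λ k → sum-cong-≗ λ i → sym (*-distribˡ-sum (h i k) (c k))) ⟩
    ∑[ k < n ] ∑[ i < n ] (h i k * degree K k)
      ≡⟨ sum-cong-≗ (λ k → sym (*-distribʳ-sum (degree K k) (λ i → h i k))) ⟩
    ∑[ k < n ] ((∑[ i < n ] h i k) * degree K k)
      ≡⟨ sum-cong-≗ (λ k → cong (_* degree K k) (sum-cong-≗ λ i → cong ⟦_⟧ (Graph.sym H i k))) ⟩
    ∑[ k < n ] (degree H k * degree K k)
      ∎
    where
    open ≡-Reasoning
    h c : Fin n → Fin n → ℕ
    h i k = ⟦ adj H i k ⟧
    c k j = ⟦ adj K k j ⟧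

m*n+1≡m+n : ∀ {m n} → 1 ≤ m → 1 ≤ n → (2 ≤ m → 2 ≤ n → ⊥) → m * n + 1 ≡ m + n
m*n+1≡m+n {suc zero}    {n}           _ _ _        = trans (cong (_+ 1) (+-identityʳ n)) (+-comm n 1)
m*n+1≡m+n {suc (suc m)} {suc zero}    _ _ _        = cong (_+ 1) (*-identityʳ (suc (suc m)))
m*n+1≡m+n {suc (suc m)} {suc (suc n)} _ _ not-both = ⊥-elim (not-both (s≤s (s≤s z≤n)) (s≤s (s≤s z≤n)))

acyclic-product-degreeSum : ∀ {G H K : Graph n} → Acyclic G → (∀ v → ∃ (Adj G v)) → IsProduct G H K →
                            degreeSum G + n ≡ degreeSum H + degreeSum K
acyclic-product-degreeSum {n} {G} {H} {K} acyclic neighbour GHK = begin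
  degreeSum G + n
    ≡⟨ cong₂ _+_ HK.degreeSum≡∑degree*degree (sym ∑-1) ⟩
  ∑[ v < n ] (degree H v * degree K v) + ∑[ v < n ] 1
    ≡⟨ ∑-distrib-+ (λ v → degree H v * degree K v) (λ _ → 1) ⟨
  ∑[ v < n ] (degree H v * degree K v + 1)            ≡⟨ sum-cong-≗ degree-identity ⟩
  ∑[ v < n ] (degree H v + degree K v)                ≡⟨ ∑-distrib-+ (degree H) (degree K) ⟩
  degreeSum H + degreeSum K                           ∎
  where
  open ≡-Reasoning
  module HK = Product {G = G} {H} {K} GHK
  module KH = Product {G = G} {K} {H} (IsProduct-comm {G = G} {H} {K} GHK)
  degree-identity : ∀ v → degree H v * degree K v + 1 ≡ degree H v + degree K v
  degree-identity v = m*n+1≡m+n (HK.1≤degree (proj₂ (neighbour v))) (KH.1≤degree (proj₂ (neighbour v)))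
                                (HK.no-K₂,₂ acyclic v)

⊓≢⊓ : ∀ {a b c d} → a ≢ c → a ≢ d → b ≢ c → b ≢ d → a ⊓ b ≢ c ⊓ d
⊓≢⊓ {a} {b} {c} {d} a≢c a≢d b≢c b≢d with ⊓-sel a b | ⊓-sel c d
... | inj₁ ab≡a | inj₁ cd≡c = λ eq → a≢c (trans (sym ab≡a) (trans eq cd≡c))
... | inj₁ ab≡a | inj₂ cd≡d = λ eq → a≢d (trans (sym ab≡a) (trans eq cd≡d))
... | inj₂ ab≡b | inj₁ cd≡c = λ eq → b≢c (trans (sym ab≡b) (trans eq cd≡c))
... | inj₂ ab≡b | inj₂ cd≡d = λ eq → b≢d (trans (sym ab≡b) (trans eq cd≡d))

-- An edge ij of G has middle vertices k (i –H– k –K– j) and l (i –K– l –H– j); then kl is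
-- again an edge (k –H– i –K– l), whose middle vertices are i and j.
module Opposite {G H K : Graph n} (GHK : IsProduct G H K) where
  private
    module HK = Product {G = G} {H} {K} GHK
    module KH = Product {G = G} {K} {H} (IsProduct-comm {G = G} {H} {K} GHK)

  opposite : Fin n × Fin n → Fin n × Fin n
  opposite (i , j) = HK.middle i j , KH.middle i j

  key : Fin n × Fin n → ℕ
  key (i , j) = toℕ i ⊓ toℕ j

  module _ {i j} (e : Adj G i j) where
    private
      hik : Adj H i (HK.middle i j)
      hik = proj₁ (HK.middle-spec e)
      kkj : Adj K (HK.middle i j) j
      kkj = proj₂ (HK.middle-spec e)
      kil : Adj K i (KH.middle i j)
      kil = proj₁ (KH.middle-spec e)
      hlj : Adj H (KH.middle i j) j
      hlj = proj₂ (KH.middle-spec e)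

    opposite-adj : uncurry (Adj G) (opposite (i , j))
    opposite-adj = HK.path⇒adj (adj-sym H hik) kil

    opposite-involutive : opposite (opposite (i , j)) ≡ (i , j)
    opposite-involutive = cong₂ _,_ (HK.middle≡ (adj-sym H hik) kil) (KH.middle≡ kkj (adj-sym H hlj))

    opposite-swap : opposite (j , i) ≡ swap (opposite (i , j))
    opposite-swap = cong₂ _,_ (HK.middle≡ (adj-sym H hlj) (adj-sym K kil))
                              (KH.middle≡ (adj-sym K kkj) (adj-sym H hik))

    key-opposite : key (opposite (i , j)) ≢ key (i , j)
    key-opposite = ⊓≢⊓ (toℕ-≢ (adj⇒≢ H hik ∘ sym)) (toℕ-≢ (adj⇒≢ K kkj))
                       (toℕ-≢ (adj⇒≢ K kil ∘ sym)) (toℕ-≢ (adj⇒≢ H hlj))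
      where
      toℕ-≢ : ∀ {x y : Fin n} → x ≢ y → toℕ x ≢ toℕ y
      toℕ-≢ x≢y = x≢y ∘ toℕ-injective

  -- Since key is symmetric, the edges kept by count₂-involution form a swap-closed set.
  4∣degreeSum : 4 ∣ degreeSum G
  4∣degreeSum = subst (4 ∣_) (sym (count₂-involution involution key (λ {p} → key-opposite)))
                              (*-monoʳ-∣ 2 (count₂-even Q-symmetric (adj⇒≢ G ∘ proj₁ ∘ ∧≡true⁻)))
    where
    involution : InvolutionOn (uncurry (adj G)) opposite
    involution = record { closed = opposite-adj ; involutive = opposite-involutive }

    Q : Fin n × Fin n → Bool
    Q p = uncurry (adj G) p ∧ does (key p <? key (opposite p))

    Q-symmetric : ∀ p → Q (swap p) ≡ Q p
    Q-symmetric (i , j) = ∧-cong-if (Graph.sym G j i) λ e →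
      cong₂ (λ a b → does (a <? b)) (⊓-comm (toℕ j) (toℕ i))
            (trans (cong key (opposite-swap (adj-sym G e))) (⊓-comm (toℕ (KH.middle i j)) _))

-- Vertex orderings and adjacency matrices

relabel : Permutation′ n → Graph n → Graph n
relabel σ G = record
  { adj    = λ i j → adj G (σ ⟨$⟩ʳ i) (σ ⟨$⟩ʳ j)
  ; sym    = λ i j → Graph.sym G (σ ⟨$⟩ʳ i) (σ ⟨$⟩ʳ j)
  ; irrefl = λ i → irrefl G (σ ⟨$⟩ʳ i)
  }

relabel-walk : ∀ (σ : Permutation′ n) {G u v} → Walk G u v → Walk (relabel σ G) (σ ⟨$⟩ˡ u) (σ ⟨$⟩ˡ v)
relabel-walk σ     []      = []
relabel-walk σ {G} (e ∷ w) = subst₂ (Adj G) (sym (inverseʳ σ)) (sym (inverseʳ σ)) e ∷ relabel-walk σ w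

relabel-connected : ∀ (σ : Permutation′ n) {G} → Connected G → Connected (relabel σ G)
relabel-connected σ connected i j =
  subst₂ (Walk _) (inverseˡ σ) (inverseˡ σ) (relabel-walk σ (connected (σ ⟨$⟩ʳ i) (σ ⟨$⟩ʳ j)))

relabel-acyclic : ∀ (σ : Permutation′ n) {G} → Acyclic G → Acyclic (relabel σ G)
relabel-acyclic σ {G} acyclic (vs , 3≤length , unique , linked) = acyclic
  ( map (σ ⟨$⟩ʳ_) vs
  , subst (3 ≤_) (sym (length-map _ vs)) 3≤length
  , Unique.map⁺ σ-injective unique
  , subst (Linked (Adj G)) map-closed (Linked.map⁺ linked)
  )
  where
  σ-injective : ∀ {i j} → σ ⟨$⟩ʳ i ≡ σ ⟨$⟩ʳ j → i ≡ j
  σ-injective eq = trans (sym (inverseˡ σ)) (trans (cong (σ ⟨$⟩ˡ_) eq) (inverseˡ σ))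
  map-closed : map (σ ⟨$⟩ʳ_) (vs ++ take 1 vs) ≡ map (σ ⟨$⟩ʳ_) vs ++ take 1 (map (σ ⟨$⟩ʳ_) vs)
  map-closed = trans (map-++ _ vs (take 1 vs))
                     (cong (map (σ ⟨$⟩ʳ_) vs ++_) (sym (take-map {f = σ ⟨$⟩ʳ_} 1 vs)))

relabel-tree : ∀ (σ : Permutation′ n) {G} → IsTree G → IsTree (relabel σ G)
relabel-tree σ {G} (connected , acyclic) = relabel-connected σ connected , relabel-acyclic σ {G} acyclic

sum-tabulate : (f : Fin n → ℕ) → List.sum (tabulate f) ≡ ∑[ k < n ] f k
sum-tabulate {zero}  f = refl
sum-tabulate {suc n} f = cong (f zero +_) (sum-tabulate (f ∘ suc))

adjMatrix-product : ∀ {G H K : Graph n} {σ τ ρ} →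
                    (∀ i j → adjMatrix G σ i j ≡ (adjMatrix H τ · adjMatrix K ρ) i j) →
                    IsProduct (relabel σ G) (relabel τ H) (relabel ρ K)
adjMatrix-product {n} {G} {H} {K} {σ} {τ} {ρ} A≡BC i j = begin
  adjMatrix G σ i j                         ≡⟨ A≡BC i j ⟩
  List.sum (map BCᵢⱼ (allFin n))            ≡⟨ cong List.sum (map-tabulate id BCᵢⱼ) ⟩
  List.sum (tabulate BCᵢⱼ)                  ≡⟨ sum-tabulate BCᵢⱼ ⟩
  ∑[ k < n ] BCᵢⱼ k                         ≡⟨ sum-cong-≗ (λ k → sym (⟦∧⟧ (H′ i k) (K′ k j))) ⟩
  count (λ k → H′ i k ∧ K′ k j)             ∎
  where
  open ≡-Reasoning
  H′ K′ : Fin n → Fin n → Bool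
  H′ = adj (relabel τ H)
  K′ = adj (relabel ρ K)
  BCᵢⱼ : Fin n → ℕ
  BCᵢⱼ k = ⟦ H′ i k ⟧ * ⟦ K′ k j ⟧

2∣m⇒2∤1+m : ∀ {m} → 2 ∣ m → 2 ∤ suc m
2∣m⇒2∤1+m {m} 2∣m 2∣1+m = contradiction (∣1⇒≡1 (∣m+n∣m⇒∣n (subst (2 ∣_) (+-comm 1 m) 2∣1+m) 2∣m)) λ ()

tree-not-product : ∀ {m} {G H K : Graph (suc (suc m))} → IsTree G → ¬ IsProduct G H K
tree-not-product {m} {G} {H} {K} tree@(connected , acyclic) GHK = 2∣m⇒2∤1+m 2∣m 2∣1+m
  where
  2∣1+m : 2 ∣ suc m
  2∣1+m = *-cancelˡ-∣ 2 (subst (4 ∣_) (tree-degreeSum tree) (Opposite.4∣degreeSum {G = G} {H} {K} GHK))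

  2∣2+m : 2 ∣ 2 + m
  2∣2+m = ∣m+n∣m⇒∣n (subst (2 ∣_) (sym (acyclic-product-degreeSum {G = G} {H} {K} acyclic
                                           (connected⇒neighbour connected) GHK))
                                  (∣m∣n⇒∣m+n (degreeSum-even H) (degreeSum-even K)))
                     (degreeSum-even G)

  2∣m : 2 ∣ m
  2∣m = ∣m+n∣m⇒∣n 2∣2+m ∣-refl

theorem7p2 : (n : ℕ) → 2 ≤ n → (G : Graph n) → IsTree G → ¬ Factorizable G
theorem7p2 zero          ()       _
theorem7p2 (suc zero)    (s≤s ()) _
theorem7p2 (suc (suc m)) _        G tree (H , K , σ , τ , ρ , A≡BC) =
  tree-not-product {H = relabel τ H} {relabel ρ K} (relabel-tree σ tree)
                   (adjMatrix-product {G = G} {H} {K} {σ} {τ} {ρ} A≡BC)
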